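{- Let $G$ be a finite abelian group whose Sylow $2$-subgroup is $P=\langle a_1\rangle\times\dots\times\langle a_n\rangle$, where $a_i$ has order $2^{m_i}>1$ for $1\le i\le n$. Let $H$ be a subgroup of $G$ such that $H\cap P$ is cyclic. (a) $H$ is a perfect code of $G$ if and only if either $H\cap P$ is trivial or the projection of $H\cap P$ onto $\langle a_i\rangle$ (with respect to the given direct decomposition of $P$) equals $\langle a_i\rangle$ for at least one $i\in\{1,\dots,n\}$. (b) $H$ is a total perfect code of $G$ if and only if the projection of $H\cap P$ onto $\langle a_i\rangle$ equals $\langle a_i\rangle$ for at least one $i\in\{1,\dots,n\}$.
   Context: All groups and graphs are finite; $e$ denotes the identity. For a group $G$ and $S\subseteq G$ with $e\notin S$ and $S^{ -1}=S$, the Cayley graph $\mathrm{Cay}(G,S)$ has vertex set $G$, with $x,y$ adjacent iff $yx^{ -1}\in S$. A subset $C$ of the vertex set of a graph is a perfect code if every vertex is at distance at most one from exactly one vertex of $C$; it is a total perfect code if every vertex has exactly one neighbour in $C$. A subset $C\subseteq G$ is called a perfect code (resp. total perfect code) of $G$ if it is a perfect code (resp. total perfect code) in some Cayley graph $\mathrm{Cay}(G,S)$ of $G$. -}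

module Defs where

open import Level using (0ℓ)
open import Algebra.Bundles using (AbelianGroup)
open import Data.Nat using (ℕ; zero; suc; _*_; _^_; _<_; _≤_)
open import Data.Nat.Divisibility using (_∣_)
open import Data.Fin using (Fin)
import Data.Fin as F
open import Data.Product using (Σ; ∃; ∃-syntax; _×_; _,_)
open import Data.Sum using (_⊎_)
open import Data.Unit using (⊤)
open import Relation.Nullary using (¬_; Dec)
open import Relation.Binary.PropositionalEquality using (_≡_)
open import Function.Bundles using (_⇔_)

module _ (G : AbelianGroup 0ℓ 0ℓ) where
  open AbelianGroup G

  Subset : Set₁
  Subset = Carrier → Set

  Respects : Subset → Set
  Respects Q = ∀ {x y} → x ≈ y → Q x → Q y

  pow : Carrier → ℕ → Carrier
  pow g zero    = ε
  pow g (suc k) = g ∙ pow g k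

  prodF : (n : ℕ) → (Fin n → Carrier) → Carrier
  prodF zero    f = ε
  prodF (suc n) f = f F.zero ∙ prodF n (λ i → f (F.suc i))

  HasSize : Subset → ℕ → Set
  HasSize Q N = Σ (Fin N → Carrier) λ f →
      (∀ i → Q (f i))
    × (∀ i j → f i ≈ f j → i ≡ j)
    × (∀ x → Q x → ∃[ i ] f i ≈ x)

  IsFiniteGroup : Set
  IsFiniteGroup = (∃[ N ] HasSize (λ _ → ⊤) N) × (∀ x y → Dec (x ≈ y))

  IsSubgroup : Subset → Set
  IsSubgroup H = Respects H × H ε
               × (∀ {x y} → H x → H y → H (x ∙ y))
               × (∀ {x} → H x → H (x ⁻¹))

  ⟨_⟩ : Carrier → Subset
  ⟨ g ⟩ x = ∃[ k ] x ≈ pow g k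

  HasOrder : Carrier → ℕ → Set
  HasOrder g k = 0 < k × pow g k ≈ ε × (∀ j → 0 < j → j < k → ¬ (pow g j ≈ ε))

  IsSylow : ℕ → Subset → Set
  IsSylow p P = IsSubgroup P × ∃[ k ] ∃[ r ]
    (HasSize P (p ^ k) × HasSize (λ _ → ⊤) (p ^ k * r) × ¬ (p ∣ r))

  _∩_ : Subset → Subset → Subset
  (A ∩ B) x = A x × B x

  SameSet : Subset → Subset → Set
  SameSet A B = ∀ x → (A x ⇔ B x)

  IsCyclic : Subset → Set
  IsCyclic A = ∃[ g ] SameSet A ⟨ g ⟩

  IsTrivial : Subset → Set
  IsTrivial A = ∀ x → A x → x ≈ ε

  module _ (n : ℕ) (a : Fin n → Carrier) where
    Gen : Subset
    Gen x = Σ (Fin n → ℕ) λ k → x ≈ prodF n (λ i → pow (a i) (k i))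

    IsDirect : (Fin n → ℕ) → Set
    IsDirect ord = ∀ (k k' : Fin n → ℕ) → (∀ i → k i < ord i) → (∀ i → k' i < ord i)
      → prodF n (λ i → pow (a i) (k i)) ≈ prodF n (λ i → pow (a i) (k' i))
      → ∀ i → k i ≡ k' i

    ProjIs : Fin n → Carrier → Carrier → Set
    ProjIs i x y = Σ (Fin n → ℕ) λ k → (x ≈ prodF n (λ j → pow (a j) (k j)) × y ≈ pow (a i) (k i))

    ProjEqualsFactor : Subset → Fin n → Set
    ProjEqualsFactor A i = SameSet (λ y → ∃[ x ] (A x × ProjIs i x y)) ⟨ a i ⟩

  IsConnectionSet : Subset → Set
  IsConnectionSet S = Respects S × ¬ S ε × (∀ {s} → S s → S (s ⁻¹))

  Adj : Subset → Carrier → Carrier → Set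
  Adj S x y = S (y ∙ x ⁻¹)

  PerfectCodeIn : Subset → Subset → Set
  PerfectCodeIn S C = ∀ x → ∃[ c ] ((C c × (c ≈ x ⊎ Adj S x c))
    × (∀ c' → C c' → (c' ≈ x ⊎ Adj S x c') → c' ≈ c))

  TotalPerfectCodeIn : Subset → Subset → Set
  TotalPerfectCodeIn S C = ∀ x → ∃[ c ] ((C c × Adj S x c)
    × (∀ c' → C c' → Adj S x c' → c' ≈ c))

  IsPerfectCode : Subset → Set₁
  IsPerfectCode C = ∃[ S ] (IsConnectionSet S × PerfectCodeIn S C)

  IsTotalPerfectCode : Subset → Set₁
  IsTotalPerfectCode C = ∃[ S ] (IsConnectionSet S × TotalPerfectCodeIn S C)

-- A subgroup H of a finite abelian group is a perfect code iff every g with g² ∈ H admits some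
-- h ∈ H with (gh)² = e, and a total perfect code iff moreover H contains an involution. Necessity
-- compares the codeword adjacent to g with c⁻¹g²; for sufficiency the connection set takes one
-- element from each coset of H, chosen compatibly with inversion.
--
-- As the index of P is odd, every g differs from an element of P by a power of g², and h² ∈ P
-- forces h ∈ P, so the criterion only involves the cyclic 2-group Q = H ∩ P = ⟨q⟩. Writing
-- q = ∏ aᵢ^kᵢ, the projection of Q onto ⟨aᵢ⟩ is all of ⟨aᵢ⟩ exactly when kᵢ is odd. If some kᵢ
-- is odd, every square in Q is the square of an element of Q, which yields the criterion; if all
-- kᵢ are even, q is a square in P and the criterion forces q = e.

module Submission where

open import Defs
open import Level using (0ℓ)
open import Algebra.Bundles using (AbelianGroup)
open import Data.Nat using (ℕ; zero; suc; _+_; _*_; _∸_; _%_; _/_; _≤_; _<_; _^_; s≤s; z≤n; NonZero)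
import Data.Nat as ℕ
open import Data.Nat.Properties
  using (≤-antisym; ≤-trans; ≤-reflexive; m≤m+n; *-comm; +-identityʳ; *-monoʳ-≤; *-cancelʳ-≡;
         m^n>0; m^n≢0; m+[n∸m]≡n; ^-distribˡ-+-*; +-0-commutativeMonoid)
open import Data.Nat.DivMod using (m%n<n; m≡m%n+[m/n]*n; %-distribˡ-*; m*n%n≡0; m∣n⇒o%n%m≡o%m)
open import Data.Nat.Divisibility using (_∣_; m∣m*n; ∣n⇒∣m*n; m%n≡0⇒n∣m; n∣m⇒m%n≡0)
open import Data.Fin using (Fin)
import Data.Fin as F
import Data.Fin.Properties as F
open import Data.Fin.Permutation using (permutation)
open import Data.Product using (∃; ∃-syntax; _×_; _,_; proj₁; proj₂; uncurry)
open import Data.Product.Properties using (×-≡,≡→≡)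
open import Data.Sum using (_⊎_; inj₁; inj₂; [_,_])
open import Data.Empty using (⊥-elim)
open import Data.Unit using (⊤; tt)
open import Relation.Nullary using (¬_; Dec; yes; no)
open import Relation.Nullary.Decidable as Dec using (_⊎-dec_; _×-dec_; ¬?)
open import Relation.Unary using (Decidable; _⊆_)
open import Relation.Binary.Definitions using (tri<; tri≈; tri>)
open import Relation.Binary.PropositionalEquality as ≡ using (_≡_)
open import Function.Base using (_∘_; id)
open import Function.Bundles using (_⇔_; mk⇔; Equivalence)
open import Function.Properties.Equivalence using () renaming (trans to ⇔-trans)

module FinCombinatorics where

  Least : ∀ {N} → (Fin N → Set) → Fin N → Set
  Least D k = D k × (∀ j → j F.< k → ¬ D j)

  least : ∀ {N} {D : Fin N → Set} → Decidable D → ∃ D → ∃ (Least D)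
  least {zero} _ (() , _)
  least {suc N} D? (k , Dk) with D? F.zero
  ... | yes D0 = F.zero , D0 , λ _ ()
  ... | no ¬D0 with k | Dk
  ...   | F.zero  | D0 = ⊥-elim (¬D0 D0)
  ...   | F.suc k | Dsk with least (λ j → D? (F.suc j)) (k , Dsk)
  ...     | k′ , Dk′ , below = F.suc k′ , Dk′ , λ where
              F.zero    _           → ¬D0
              (F.suc j) (s≤s j<k) → below j j<k

  Least-unique : ∀ {N} {D D′ : Fin N → Set} → D ⊆ D′ → D′ ⊆ D →
                 ∀ {k k′} → Least D k → Least D′ k′ → k ≡ k′
  Least-unique D⊆D′ D′⊆D {k} {k′} (Dk , belowk) (D′k′ , belowk′) with F.<-cmp k k′
  ... | tri< k<k′ _ _ = ⊥-elim (belowk′ k k<k′ (D⊆D′ Dk))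
  ... | tri≈ _ k≡k′ _ = k≡k′
  ... | tri> _ _ k′<k = ⊥-elim (belowk k′ k′<k (D′⊆D D′k′))

  record Enumeration {N} (D : Fin N → Set) : Set where
    field
      size      : ℕ
      elem      : Fin size → Fin N
      elem∈     : ∀ i → D (elem i)
      injective : ∀ i j → elem i ≡ elem j → i ≡ j
      covers    : ∀ k → D k → ∃[ i ] elem i ≡ k

  enumerate : ∀ {N} {D : Fin N → Set} → Decidable D → Enumeration D
  enumerate {zero} _ = record
    { size = 0 ; elem = λ () ; elem∈ = λ () ; injective = λ () ; covers = λ () }
  enumerate {suc N} {D} D? with enumerate (λ j → D? (F.suc j)) | D? F.zero
  ... | E | yes D0 = record
    { size = suc size ; elem = elem′ ; elem∈ = elem′∈ ; injective = injective′ ; covers = covers′ }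
    where
    open Enumeration E
    elem′ : Fin (suc size) → Fin (suc N)
    elem′ F.zero    = F.zero
    elem′ (F.suc i) = F.suc (elem i)
    elem′∈ : ∀ i → D (elem′ i)
    elem′∈ F.zero    = D0
    elem′∈ (F.suc i) = elem∈ i
    injective′ : ∀ i j → elem′ i ≡ elem′ j → i ≡ j
    injective′ F.zero    F.zero    _  = ≡.refl
    injective′ (F.suc i) (F.suc j) eq = ≡.cong F.suc (injective i j (F.suc-injective eq))
    covers′ : ∀ k → D k → ∃[ i ] elem′ i ≡ k
    covers′ F.zero    _   = F.zero , ≡.refl
    covers′ (F.suc k) Dsk = let i , eq = covers k Dsk in F.suc i , ≡.cong F.suc eq
  ... | E | no ¬D0 = record
    { size = size ; elem = λ i → F.suc (elem i) ; elem∈ = elem∈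
    ; injective = λ i j eq → injective i j (F.suc-injective eq) ; covers = covers′ }
    where
    open Enumeration E
    covers′ : ∀ k → D k → ∃[ i ] F.suc (elem i) ≡ k
    covers′ F.zero    D0  = ⊥-elim (¬D0 D0)
    covers′ (F.suc k) Dsk = let i , eq = covers k Dsk in i , ≡.cong F.suc eq

  injections⇒*≡ : ∀ {m n N} (f : Fin m × Fin n → Fin N) (g : Fin N → Fin m × Fin n) →
                  (∀ p q → f p ≡ f q → p ≡ q) → (∀ k l → g k ≡ g l → k ≡ l) → m * n ≡ N
  injections⇒*≡ {m} {n} f g f-injective g-injective = ≤-antisym
    (F.injective⇒≤ {f = λ k → f (F.remQuot {m} n k)} λ {k} {l} eq →
      ≡.trans (≡.sym (F.combine-remQuot {m} n k))
        (≡.trans (≡.cong (uncurry F.combine) (f-injective _ _ eq)) (F.combine-remQuot {m} n l)))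
    (F.injective⇒≤ {f = λ k → uncurry F.combine (g k)} λ {k} {l} eq →
      g-injective k l (×-≡,≡→≡ (F.combine-injective _ _ _ _ eq)))

module Powers (G : AbelianGroup 0ℓ 0ℓ) where
  open AbelianGroup G
  open import Algebra.Properties.CommutativeMonoid.Mult commutativeMonoid
    using (×-congʳ; ×-homo-+; ×-assocˡ; ×-distrib-+) renaming (_×_ to _·_)
  open import Algebra.Properties.CommutativeMonoid.Sum commutativeMonoid
    using (sum; sum-cong-≋; ∑-distrib-+; sum-replicate; sum-replicate-zero)
  open import Algebra.Properties.Group group using (ε⁻¹≈ε)
  open import Algebra.Properties.AbelianGroup G using (⁻¹-∙-comm)

  pow≡· : ∀ x k → pow G x k ≡ k · x
  pow≡· x zero    = ≡.refl
  pow≡· x (suc k) = ≡.cong (x ∙_) (pow≡· x k)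

  pow-cong : ∀ {x y} k → x ≈ y → pow G x k ≈ pow G y k
  pow-cong {x} {y} k x≈y rewrite pow≡· x k | pow≡· y k = ×-congʳ k x≈y

  pow-+ : ∀ x j k → pow G x (j + k) ≈ pow G x j ∙ pow G x k
  pow-+ x j k rewrite pow≡· x (j + k) | pow≡· x j | pow≡· x k = ×-homo-+ x j k

  pow-* : ∀ x j k → pow G x (j * k) ≈ pow G (pow G x k) j
  pow-* x j k rewrite pow≡· x (j * k) | pow≡· x k | pow≡· (k · x) j = sym (×-assocˡ x j k)

  pow-∙ : ∀ x y k → pow G (x ∙ y) k ≈ pow G x k ∙ pow G y k
  pow-∙ x y k rewrite pow≡· (x ∙ y) k | pow≡· x k | pow≡· y k = ×-distrib-+ x y k

  pow-ε : ∀ k → pow G ε k ≈ ε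
  pow-ε zero    = refl
  pow-ε (suc k) = trans (identityˡ _) (pow-ε k)

  pow-⁻¹ : ∀ x k → pow G (x ⁻¹) k ≈ pow G x k ⁻¹
  pow-⁻¹ x zero    = sym ε⁻¹≈ε
  pow-⁻¹ x (suc k) = trans (∙-congˡ (pow-⁻¹ x k)) (⁻¹-∙-comm x _)

  pow-1 : ∀ x → pow G x 1 ≈ x
  pow-1 = identityʳ

  pow-pow-comm : ∀ x j k → pow G (pow G x j) k ≈ pow G (pow G x k) j
  pow-pow-comm x j k = trans (sym (pow-* x k j))
    (trans (reflexive (≡.cong (pow G x) (*-comm k j))) (pow-* x j k))

  pow-square : ∀ x k → pow G (x ∙ x) k ≈ pow G x (k + k)
  pow-square x k = trans (pow-∙ x x k) (sym (pow-+ x k k))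

  pow-*-≈ε : ∀ x e k → pow G x e ≈ ε → pow G x (k * e) ≈ ε
  pow-*-≈ε x e k xᵉ≈ε = trans (pow-* x k e) (trans (pow-cong k xᵉ≈ε) (pow-ε k))

  prodF≡sum : ∀ n f → prodF G n f ≡ sum f
  prodF≡sum zero    f = ≡.refl
  prodF≡sum (suc n) f = ≡.cong (f F.zero ∙_) (prodF≡sum n (λ i → f (F.suc i)))

  prodF-cong : ∀ n {f g : Fin n → Carrier} → (∀ i → f i ≈ g i) → prodF G n f ≈ prodF G n g
  prodF-cong n {f} {g} f≈g rewrite prodF≡sum n f | prodF≡sum n g = sum-cong-≋ f≈g

  prodF-∙ : ∀ n (f g : Fin n → Carrier) →
            prodF G n (λ i → f i ∙ g i) ≈ prodF G n f ∙ prodF G n g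
  prodF-∙ n f g rewrite prodF≡sum n (λ i → f i ∙ g i) | prodF≡sum n f | prodF≡sum n g =
    ∑-distrib-+ f g

  prodF-const : ∀ n x → prodF G n (λ _ → x) ≈ pow G x n
  prodF-const n x rewrite prodF≡sum n (λ _ → x) | pow≡· x n = sum-replicate n

  prodF-ε : ∀ n → prodF G n (λ _ → ε) ≈ ε
  prodF-ε n rewrite prodF≡sum n (λ _ → ε) = sum-replicate-zero n

  pow-prodF : ∀ n (f : Fin n → Carrier) k → pow G (prodF G n f) k ≈ prodF G n (λ i → pow G (f i) k)
  pow-prodF zero    f k = pow-ε k
  pow-prodF (suc n) f k = trans (pow-∙ _ _ k) (∙-congˡ (pow-prodF n (λ i → f (F.suc i)) k))

module Subgroup (G : AbelianGroup 0ℓ 0ℓ) {H : Subset G} (sg : IsSubgroup G H) where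
  open AbelianGroup G
  open Powers G

  resp : Respects G H
  resp = proj₁ sg

  ε∈ : H ε
  ε∈ = proj₁ (proj₂ sg)

  ∙∈ : ∀ {x y} → H x → H y → H (x ∙ y)
  ∙∈ = proj₁ (proj₂ (proj₂ sg))

  ⁻¹∈ : ∀ {x} → H x → H (x ⁻¹)
  ⁻¹∈ = proj₂ (proj₂ (proj₂ sg))

  pow∈ : ∀ {x} k → H x → H (pow G x k)
  pow∈ zero    _  = ε∈
  pow∈ (suc k) Hx = ∙∈ Hx (pow∈ k Hx)

  ∙∈-cancelʳ : ∀ {x y} → H (x ∙ y) → H y → H x
  ∙∈-cancelʳ {x} {y} Hxy Hy =
    resp (trans (assoc x y (y ⁻¹)) (trans (∙-congˡ (inverseʳ y)) (identityʳ x))) (∙∈ Hxy (⁻¹∈ Hy))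

module Listing (A : AbelianGroup 0ℓ 0ℓ) {Q : Subset A} {N : ℕ} (hQ : HasSize A Q N) where
  open AbelianGroup A

  element : Fin N → Carrier
  element = proj₁ hQ

  element∈ : ∀ k → Q (element k)
  element∈ = proj₁ (proj₂ hQ)

  element-injective : ∀ k l → element k ≈ element l → k ≡ l
  element-injective = proj₁ (proj₂ (proj₂ hQ))

  position : ∀ x → Q x → Fin N
  position x Qx = proj₁ (proj₂ (proj₂ (proj₂ hQ)) x Qx)

  element-position : ∀ x (Qx : Q x) → element (position x Qx) ≈ x
  element-position x Qx = proj₂ (proj₂ (proj₂ (proj₂ hQ)) x Qx)

module FiniteAbelianGroup (A : AbelianGroup 0ℓ 0ℓ) where
  open AbelianGroup A
  open Powers A
  open import Algebra.Properties.CommutativeMonoid.Sum commutativeMonoid using (sum; sum-permute)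
  open import Algebra.Properties.Group group using (identityʳ-unique)
  open import Relation.Binary.Reasoning.Setoid setoid

  -- Translation by y permutes the elements, so their product is also y^N times itself.
  pow-size≈ε : ∀ {N} → HasSize A (λ _ → ⊤) N → ∀ y → pow A y N ≈ ε
  pow-size≈ε {N} hA y =
    identityʳ-unique (prodF A N f) (pow A y N) translated-product
    where
    open Listing A hA renaming (element to f)
    translate : Carrier → Fin N → Fin N
    translate z k = position (z ∙ f k) tt
    f-translate : ∀ z k → f (translate z k) ≈ z ∙ f k
    f-translate z k = element-position (z ∙ f k) tt
    translate-inverse : ∀ w z k → w ∙ z ≈ ε → translate w (translate z k) ≡ k
    translate-inverse w z k w∙z≈ε = element-injective _ _ (begin
      f (translate w (translate z k))     ≈⟨ f-translate w _ ⟩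
      w ∙ f (translate z k)               ≈⟨ ∙-congˡ (f-translate z k) ⟩
      w ∙ (z ∙ f k)                       ≈⟨ assoc w z (f k) ⟨
      (w ∙ z) ∙ f k                       ≈⟨ ∙-congʳ w∙z≈ε ⟩
      ε ∙ f k                             ≈⟨ identityˡ (f k) ⟩
      f k                                 ∎)
    translation = permutation (translate y) (translate (y ⁻¹))
      (λ k → translate-inverse y (y ⁻¹) k (inverseʳ y))
      (λ k → translate-inverse (y ⁻¹) y k (inverseˡ y))
    translated-product : prodF A N f ∙ pow A y N ≈ prodF A N f
    translated-product = begin
      prodF A N f ∙ pow A y N                ≈⟨ comm _ _ ⟩
      pow A y N ∙ prodF A N f                ≈⟨ ∙-congʳ (prodF-const N y) ⟨
      prodF A N (λ _ → y) ∙ prodF A N f      ≈⟨ prodF-∙ N (λ _ → y) f ⟨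
      prodF A N (λ k → y ∙ f k)              ≈⟨ prodF-cong N (f-translate y) ⟨
      prodF A N (λ k → f (translate y k))    ≡⟨ prodF≡sum N _ ⟩
      sum (λ k → f (translate y k))          ≈⟨ sum-permute f translation ⟨
      sum f                                  ≡⟨ prodF≡sum N f ⟨
      prodF A N f                            ∎

module Quotient (G : AbelianGroup 0ℓ 0ℓ) {P : Subset G} (sgP : IsSubgroup G P) where
  open AbelianGroup G
  open Subgroup G sgP
  open import Algebra.Properties.Group group using (x≈y⇒x∙y⁻¹≈ε; ⁻¹-anti-homo-∙; ⁻¹-involutive)
  open import Algebra.Properties.AbelianGroup G using (⁻¹-∙-comm; xyx⁻¹≈y)
  open import Algebra.Properties.Monoid monoid using (cancelᶜ)
  open import Algebra.Properties.CommutativeSemigroup commutativeSemigroup using (interchange)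

  infix 4 _∼_
  _∼_ : Carrier → Carrier → Set
  x ∼ y = P (x ∙ y ⁻¹)

  ≈⇒∼ : ∀ {x y} → x ≈ y → x ∼ y
  ≈⇒∼ x≈y = resp (sym (x≈y⇒x∙y⁻¹≈ε x≈y)) ε∈

  ∼-sym : ∀ {x y} → x ∼ y → y ∼ x
  ∼-sym {x} {y} x∼y = resp (trans (⁻¹-anti-homo-∙ x (y ⁻¹)) (∙-congʳ (⁻¹-involutive y))) (⁻¹∈ x∼y)

  ∼-trans : ∀ {x y z} → x ∼ y → y ∼ z → x ∼ z
  ∼-trans {x} {y} {z} x∼y y∼z = resp (cancelᶜ (inverseˡ y) x (z ⁻¹)) (∙∈ x∼y y∼z)

  ∙-cong-∼ : ∀ {x y u v} → x ∼ y → u ∼ v → x ∙ u ∼ y ∙ v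
  ∙-cong-∼ {x} {y} {u} {v} x∼y u∼v =
    resp (trans (interchange x (y ⁻¹) u (v ⁻¹)) (∙-congˡ (⁻¹-∙-comm y v))) (∙∈ x∼y u∼v)

  ⁻¹-cong-∼ : ∀ {x y} → x ∼ y → x ⁻¹ ∼ y ⁻¹
  ⁻¹-cong-∼ {x} {y} x∼y = resp (sym (⁻¹-∙-comm x (y ⁻¹))) (⁻¹∈ x∼y)

  ∙∈-∼ : ∀ {x p} → P p → x ∙ p ∼ x
  ∙∈-∼ {x} {p} Pp = resp (sym (xyx⁻¹≈y x p)) Pp

  quotient : AbelianGroup 0ℓ 0ℓ
  quotient = record
    { Carrier = Carrier ; _≈_ = _∼_ ; _∙_ = _∙_ ; ε = ε ; _⁻¹ = _⁻¹
    ; isAbelianGroup = record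
      { isGroup = record
        { isMonoid = record
          { isSemigroup = record
            { isMagma = record
              { isEquivalence = record { refl = ≈⇒∼ refl ; sym = ∼-sym ; trans = ∼-trans }
              ; ∙-cong = ∙-cong-∼ }
            ; assoc = λ x y z → ≈⇒∼ (assoc x y z) }
          ; identity = (λ x → ≈⇒∼ (identityˡ x)) , (λ x → ≈⇒∼ (identityʳ x)) }
        ; inverse = (λ x → ≈⇒∼ (inverseˡ x)) , (λ x → ≈⇒∼ (inverseʳ x))
        ; ⁻¹-cong = ⁻¹-cong-∼ }
      ; comm = λ x y → ≈⇒∼ (comm x y) } }

  pow-quotient : ∀ y k → pow quotient y k ≡ pow G y k
  pow-quotient y zero    = ≡.refl
  pow-quotient y (suc k) = ≡.cong (y ∙_) (pow-quotient y k)

module Lagrange (G : AbelianGroup 0ℓ 0ℓ) (_≟_ : ∀ x y → Dec (AbelianGroup._≈_ G x y))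
                {P : Subset G} (sgP : IsSubgroup G P)
                {b : ℕ} (hP : HasSize G P b) {N : ℕ} (hG : HasSize G (λ _ → ⊤) N) where
  open AbelianGroup G
  open Subgroup G sgP
  open Quotient G sgP
  open FinCombinatorics
  open FiniteAbelianGroup quotient using (pow-size≈ε)
  open import Algebra.Properties.Group group using (ε⁻¹≈ε; quasigroup)
  open import Algebra.Properties.Quasigroup quasigroup using (cancelˡ)
  open import Algebra.Properties.Monoid monoid using () renaming (cancelˡ to cancel-inverseˡ)

  open Listing G hG using (element; element-injective; position; element-position)
  open Listing G hP using () renaming
    (element to member; element∈ to member∈; element-injective to member-injective;
     position to locate; element-position to member-locate)

  P? : Decidable P
  P? x = Dec.map′ (λ (j , mⱼ≈x) → resp mⱼ≈x (member∈ j)) (λ Px → locate x Px , member-locate x Px)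
                  (F.any? (λ j → member j ≟ x))

  first-in-coset : ∀ z → ∃ (Least (λ k → element k ∼ z))
  first-in-coset z = least (λ k → P? _) (position z tt , ≈⇒∼ (element-position z tt))

  representative : Carrier → Fin N
  representative z = proj₁ (first-in-coset z)

  representative-∼ : ∀ z → element (representative z) ∼ z
  representative-∼ z = proj₁ (proj₂ (first-in-coset z))

  representative-cong : ∀ {z z′} → z ∼ z′ → representative z ≡ representative z′
  representative-cong {z} {z′} z∼z′ =
    Least-unique (λ x∼z → ∼-trans x∼z z∼z′) (λ x∼z′ → ∼-trans x∼z′ (∼-sym z∼z′))
                 (proj₂ (first-in-coset z)) (proj₂ (first-in-coset z′))

  representatives : Enumeration (λ k → representative (element k) ≡ k)
  representatives = enumerate (λ k → representative (element k) F.≟ k)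

  index : ℕ
  index = Enumeration.size representatives

  coset : Fin index → Carrier
  coset i = element (Enumeration.elem representatives i)

  coset-injective : ∀ i j → coset i ∼ coset j → i ≡ j
  coset-injective i j ci∼cj = injective i j
    (≡.trans (≡.sym (elem∈ i)) (≡.trans (representative-cong ci∼cj) (elem∈ j)))
    where open Enumeration representatives

  coset-covers : ∀ z → ∃[ i ] coset i ∼ z
  coset-covers z = let i , eq = covers _ (representative-cong (representative-∼ z)) in
    i , ≡.subst (λ k → element k ∼ z) (≡.sym eq) (representative-∼ z)
    where open Enumeration representatives

  pow-index∈ : ∀ y → P (pow G y index)
  pow-index∈ y = resp (trans (∙-congˡ ε⁻¹≈ε) (identityʳ _))
    (≡.subst (λ t → P (t ∙ ε ⁻¹)) (pow-quotient y index)
      (pow-size≈ε (coset , (λ _ → tt) , coset-injective , (λ z _ → coset-covers z)) y))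

  compose : Fin index × Fin b → Carrier
  compose (i , j) = coset i ∙ member j

  decompose : Carrier → Fin index × Fin b
  decompose x = let i , cᵢ∼x = coset-covers x in
    i , locate (coset i ⁻¹ ∙ x) (resp (comm _ _) (∼-sym cᵢ∼x))

  compose-decompose : ∀ x → compose (decompose x) ≈ x
  compose-decompose x = trans (∙-congˡ (member-locate _ _)) (cancel-inverseˡ (inverseʳ (coset _)) x)

  compose-injective : ∀ p q → compose p ≈ compose q → p ≡ q
  compose-injective (i , j) (i′ , j′) eq with coset-injective i i′
    (∼-trans (∼-sym (∙∈-∼ (member∈ j))) (∼-trans (≈⇒∼ eq) (∙∈-∼ (member∈ j′))))
  ... | ≡.refl = ≡.cong (i ,_) (member-injective j j′ (cancelˡ (coset i) (member j) (member j′) eq))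

  index*size≡size : index * b ≡ N
  index*size≡size = injections⇒*≡ (λ p → position (compose p) tt) (λ k → decompose (element k))
    (λ p q eq → compose-injective p q
      (trans (sym (element-position _ tt)) (trans (reflexive (≡.cong element eq)) (element-position _ tt))))
    (λ k l eq → element-injective k l
      (trans (sym (compose-decompose _)) (trans (reflexive (≡.cong compose eq)) (compose-decompose _))))

module PowersOfTwo where

  parity : ∀ k → k % 2 ≡ 0 ⊎ k % 2 ≡ 1
  parity k with k % 2 | m%n<n k 2
  ... | 0           | _               = inj₁ ≡.refl
  ... | 1           | _               = inj₂ ≡.refl
  ... | suc (suc _) | s≤s (s≤s ())

  odd-form : ∀ k → k % 2 ≡ 1 → k ≡ 1 + k / 2 * 2
  odd-form k k-odd = ≡.trans (m≡m%n+[m/n]*n k 2) (≡.cong (_+ k / 2 * 2) k-odd)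

  even-form : ∀ k → k % 2 ≡ 0 → k ≡ k / 2 * 2
  even-form k k-even = ≡.trans (m≡m%n+[m/n]*n k 2) (≡.cong (_+ k / 2 * 2) k-even)

  double-even : ∀ k → (k + k) % 2 ≡ 0
  double-even k = ≡.trans (≡.cong (λ t → (k + t) % 2) (≡.sym (+-identityʳ k)))
                         (≡.trans (≡.cong (_% 2) (*-comm 2 k)) (m*n%n≡0 k 2))

  *-odd⇒odd : ∀ s k → (s * k) % 2 ≡ 1 → k % 2 ≡ 1
  *-odd⇒odd s k sk-odd with parity k
  ... | inj₂ k-odd  = k-odd
  ... | inj₁ k-even with ≡.trans (≡.sym sk-odd) (n∣m⇒m%n≡0 _ 2 (∣n⇒∣m*n s (m%n≡0⇒n∣m k 2 k-even)))
  ...   | ()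

  *-even⇒even : ∀ t k → (t * k) % 2 ≡ 0 → k % 2 ≡ 1 → t % 2 ≡ 0
  *-even⇒even t k tk-even k-odd with parity t
  ... | inj₁ t-even = t-even
  ... | inj₂ t-odd with ≡.trans (≡.sym tk-even)
                       (≡.trans (%-distribˡ-* t k 2) (≡.cong₂ (λ u v → (u * v) % 2) t-odd k-odd))
  ...   | ()

  1<2^ : ∀ e → 1 ≤ e → 1 < 2 ^ e
  1<2^ (suc e) _ = *-monoʳ-≤ 2 (m^n>0 2 e)

  2^-split : ∀ {e f} → e ≤ f → 2 ^ f ≡ 2 ^ (f ∸ e) * 2 ^ e
  2^-split {e} {f} e≤f = ≡.trans (≡.cong (2 ^_) (≡.sym (m+[n∸m]≡n e≤f)))
    (≡.trans (^-distribˡ-+-* 2 e (f ∸ e)) (*-comm (2 ^ e) _))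

  %2^-%2 : ∀ t e → .{{_ : NonZero (2 ^ e)}} → 1 ≤ e → (t % 2 ^ e) % 2 ≡ t % 2
  %2^-%2 t (suc e) _ = m∣n⇒o%n%m≡o%m 2 (2 ^ suc e) t (m∣m*n (2 ^ e))

module CyclicSubgroup (G : AbelianGroup 0ℓ 0ℓ) where
  open AbelianGroup G
  open Powers G
  open import Algebra.Properties.Group group using (inverseʳ-unique)

  ∈⟨⟩ : ∀ y → ⟨_⟩ G y y
  ∈⟨⟩ y = 1 , sym (pow-1 y)

  ⁻¹∈⟨⟩ : ∀ {y} e → .{{NonZero e}} → pow G y e ≈ ε → ⟨_⟩ G y (y ⁻¹)
  ⁻¹∈⟨⟩ {y} (suc d) yᵉ≈ε = d , sym (inverseʳ-unique y (pow G y d) yᵉ≈ε)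

  ⟨⟩-isSubgroup : ∀ {y} e → .{{NonZero e}} → pow G y e ≈ ε → IsSubgroup G (⟨_⟩ G y)
  ⟨⟩-isSubgroup {y} e yᵉ≈ε =
      (λ x≈x′ (k , x≈) → k , trans (sym x≈x′) x≈)
    , (0 , refl)
    , (λ (j , x≈) (k , x′≈) → j + k , trans (∙-cong x≈ x′≈) (sym (pow-+ y j k)))
    , λ (k , x≈) → let d , y⁻¹≈ = ⁻¹∈⟨⟩ e yᵉ≈ε in
        k * d , trans (⁻¹-cong x≈) (trans (sym (pow-⁻¹ y k)) (trans (pow-cong k y⁻¹≈) (sym (pow-* y k d))))

module TwoPowerElements (G : AbelianGroup 0ℓ 0ℓ) where
  open AbelianGroup G
  open Powers G
  open CyclicSubgroup G
  open PowersOfTwo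
  open import Algebra.Properties.Group group using (inverseʳ-unique; identityʳ-unique)
  open import Algebra.Properties.Monoid monoid using (cancelʳ)
  open import Relation.Binary.Reasoning.Setoid setoid

  SquaresToε : Subset G
  SquaresToε x = x ∙ x ≈ ε

  IsInvolution : Subset G
  IsInvolution x = x ∙ x ≈ ε × ¬ x ≈ ε

  SquaresToε-resp : Respects G SquaresToε
  SquaresToε-resp x≈y x∙x≈ε = trans (∙-cong (sym x≈y) (sym x≈y)) x∙x≈ε

  IsInvolution-resp : Respects G IsInvolution
  IsInvolution-resp x≈y (x∙x≈ε , x≉ε) = SquaresToε-resp x≈y x∙x≈ε , λ y≈ε → x≉ε (trans x≈y y≈ε)

  square≈ε⇒≈⁻¹ : ∀ {x} → x ∙ x ≈ ε → x ≈ x ⁻¹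
  square≈ε⇒≈⁻¹ {x} = inverseʳ-unique x x

  pow-double : ∀ y c → pow G y (c * 2) ≈ pow G (y ∙ y) c
  pow-double y c = trans (pow-* y c 2) (pow-cong c (∙-congˡ (identityʳ y)))

  pow-odd : ∀ y c → pow G y (1 + c * 2) ≈ y ∙ pow G (y ∙ y) c
  pow-odd y c = ∙-congˡ (pow-double y c)

  pow-even : ∀ y k → k % 2 ≡ 0 → pow G y k ≈ pow G y (k / 2) ∙ pow G y (k / 2)
  pow-even y k k-even = trans (reflexive (≡.cong (pow G y) (even-form k k-even)))
                              (trans (pow-double y (k / 2)) (pow-∙ y y (k / 2)))

  pow-2^suc : ∀ x S → pow G x (2 ^ suc S) ≈ pow G (x ∙ x) (2 ^ S)
  pow-2^suc x S = trans (reflexive (≡.cong (λ t → pow G x (2 ^ S + t)) (+-identityʳ (2 ^ S))))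
                        (sym (pow-square x (2 ^ S)))

  pow-2^-odd⇒≈ε : ∀ S x u → pow G x (2 ^ S) ≈ ε → pow G x (1 + u * 2) ≈ ε → x ≈ ε
  pow-2^-odd⇒≈ε zero    x u x¹≈ε _ = trans (sym (pow-1 x)) x¹≈ε
  pow-2^-odd⇒≈ε (suc S) x u xᴱ≈ε xᵒ≈ε = begin
    x                     ≈⟨ identityʳ x ⟨
    x ∙ ε                 ≈⟨ ∙-congˡ (trans (pow-cong u x∙x≈ε) (pow-ε u)) ⟨
    x ∙ pow G (x ∙ x) u   ≈⟨ pow-odd x u ⟨
    pow G x (1 + u * 2)   ≈⟨ xᵒ≈ε ⟩
    ε                     ∎
    where
    x∙x≈ε : x ∙ x ≈ ε
    x∙x≈ε = pow-2^-odd⇒≈ε S (x ∙ x) u (trans (sym (pow-2^suc x S)) xᴱ≈ε)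
      (trans (pow-∙ x x (1 + u * 2)) (trans (∙-cong xᵒ≈ε xᵒ≈ε) (identityˡ ε)))

  self-pow⇒odd : ∀ S x c → pow G x (2 ^ S) ≈ ε → ¬ x ≈ ε → x ≈ pow G x c → c % 2 ≡ 1
  self-pow⇒odd S x c xᴱ≈ε x≉ε x≈xᶜ with parity c
  ... | inj₂ c-odd  = c-odd
  ... | inj₁ c-even with c / 2 | even-form c c-even
  ...   | zero  | c≡0    = ⊥-elim (x≉ε (trans x≈xᶜ (reflexive (≡.cong (pow G x) c≡0))))
  ...   | suc d | c≡ = ⊥-elim (x≉ε (pow-2^-odd⇒≈ε S x d xᴱ≈ε
    (identityʳ-unique x (pow G x (1 + d * 2)) (sym (trans x≈xᶜ (reflexive (≡.cong (pow G x) c≡)))))))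

  involution∈⟨⟩ : (∀ x y → Dec (x ≈ y)) → ∀ S x → pow G x (2 ^ S) ≈ ε → ¬ x ≈ ε →
                  ∃[ z ] ⟨_⟩ G x z × IsInvolution z
  involution∈⟨⟩ _≟_ zero    x x≈ε x≉ε = ⊥-elim (x≉ε (trans (sym (pow-1 x)) x≈ε))
  involution∈⟨⟩ _≟_ (suc S) x xᴱ≈ε x≉ε with (x ∙ x) ≟ ε
  ... | yes x∙x≈ε = x , ∈⟨⟩ x , x∙x≈ε , x≉ε
  ... | no x∙x≉ε  =
    let z , (k , z≈) , z-involution = involution∈⟨⟩ _≟_ S (x ∙ x) (trans (sym (pow-2^suc x S)) xᴱ≈ε) x∙x≉ε
    in z , (k + k , trans z≈ (pow-square x k)) , z-involution

  -- Writing x^k = x (x²)^c, the claim for x follows from the claim for x², whose order is smaller.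
  ∈⟨odd-pow⟩ : ∀ S x k → pow G x (2 ^ S) ≈ ε → k % 2 ≡ 1 → ⟨_⟩ G (pow G x k) x
  ∈⟨odd-pow⟩ zero    x k x≈ε _     = 0 , trans (sym (pow-1 x)) x≈ε
  ∈⟨odd-pow⟩ (suc S) x k xᴱ≈ε k-odd = resp x≈ (∙∈ (∈⟨⟩ y) (⁻¹∈ (pow∈ (k / 2) x∙x∈⟨y⟩)))
    where
    y = pow G x k
    yᵉ≈ε : pow G y (2 ^ suc S) ≈ ε
    yᵉ≈ε = trans (pow-pow-comm x k (2 ^ suc S)) (trans (pow-cong k xᴱ≈ε) (pow-ε k))
    open Subgroup G (⟨⟩-isSubgroup (2 ^ suc S) {{m^n≢0 2 (suc S)}} yᵉ≈ε)
    x≈ : y ∙ pow G (x ∙ x) (k / 2) ⁻¹ ≈ x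
    x≈ = trans (∙-congʳ (trans (reflexive (≡.cong (pow G x) (odd-form k k-odd))) (pow-odd x (k / 2))))
               (cancelʳ (inverseʳ _) x)
    x∙x∈⟨y⟩ : ⟨_⟩ G y (x ∙ x)
    x∙x∈⟨y⟩ = let t , x∙x≈ = ∈⟨odd-pow⟩ S (x ∙ x) k (trans (sym (pow-2^suc x S)) xᴱ≈ε) k-odd in
      resp (sym x∙x≈) (pow∈ t (resp (sym (pow-∙ x x k)) (∙∈ (∈⟨⟩ y) (∈⟨⟩ y))))

module PerfectCodes (G : AbelianGroup 0ℓ 0ℓ) {H : Subset G} (sgH : IsSubgroup G H) (H? : ∀ x → Dec (H x)) where
  open AbelianGroup G
  open Subgroup G sgH
  open Quotient G sgH
  open TwoPowerElements G using (SquaresToε; IsInvolution; SquaresToε-resp; IsInvolution-resp; square≈ε⇒≈⁻¹)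
  open import Algebra.Properties.Group group using (⁻¹-involutive; ⁻¹-anti-homo-∙)
  open import Algebra.Properties.Monoid monoid using (cancelʳ)
  open import Algebra.Properties.CommutativeSemigroup commutativeSemigroup using (interchange)
  open import Relation.Binary.Reasoning.Setoid setoid

  Criterion : Subset G → Set
  Criterion Good = ∀ g → H (g ∙ g) → ∃[ h ] H h × Good (g ∙ h)

  -- c⁻¹g² is also a codeword adjacent to g (as S⁻¹ = S), so it equals c.
  adjacent-codeword : ∀ {S} → IsConnectionSet G S → ∀ {g c} → H (g ∙ g) → H c → Adj G S g c →
                      (∀ c′ → H c′ → Adj G S g c′ → c′ ≈ c) → IsInvolution (g ∙ c ⁻¹)
  adjacent-codeword {S} (S-resp , ε∉S , S⁻¹) {g} {c} Hgg Hc c∙g⁻¹∈S unique =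
    square≈ε , λ g∙c⁻¹≈ε → ε∉S (S-resp (trans c∙g⁻¹-inverse g∙c⁻¹≈ε) (S⁻¹ c∙g⁻¹∈S))
    where
    c∙g⁻¹-inverse : (c ∙ g ⁻¹) ⁻¹ ≈ g ∙ c ⁻¹
    c∙g⁻¹-inverse = trans (⁻¹-anti-homo-∙ c (g ⁻¹)) (∙-congʳ (⁻¹-involutive g))
    c′ = c ⁻¹ ∙ (g ∙ g)
    c′∙g⁻¹≈ : c′ ∙ g ⁻¹ ≈ (c ∙ g ⁻¹) ⁻¹
    c′∙g⁻¹≈ = begin
      (c ⁻¹ ∙ (g ∙ g)) ∙ g ⁻¹ ≈⟨ ∙-congʳ (comm _ _) ⟩
      ((g ∙ g) ∙ c ⁻¹) ∙ g ⁻¹ ≈⟨ ∙-congʳ (assoc g g (c ⁻¹)) ⟩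
      (g ∙ (g ∙ c ⁻¹)) ∙ g ⁻¹ ≈⟨ ∙-congʳ (comm _ _) ⟩
      ((g ∙ c ⁻¹) ∙ g) ∙ g ⁻¹ ≈⟨ cancelʳ (inverseʳ g) (g ∙ c ⁻¹) ⟩
      g ∙ c ⁻¹                ≈⟨ c∙g⁻¹-inverse ⟨
      (c ∙ g ⁻¹) ⁻¹           ∎
    c′≈c : c′ ≈ c
    c′≈c = unique c′ (∙∈ (⁻¹∈ Hc) Hgg) (S-resp (sym c′∙g⁻¹≈) (S⁻¹ c∙g⁻¹∈S))
    square≈ε : (g ∙ c ⁻¹) ∙ (g ∙ c ⁻¹) ≈ ε
    square≈ε = begin
      (g ∙ c ⁻¹) ∙ (g ∙ c ⁻¹) ≈⟨ interchange g (c ⁻¹) g (c ⁻¹) ⟩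
      (g ∙ g) ∙ (c ⁻¹ ∙ c ⁻¹) ≈⟨ assoc _ _ _ ⟨
      ((g ∙ g) ∙ c ⁻¹) ∙ c ⁻¹ ≈⟨ ∙-congʳ (trans (comm _ _) c′≈c) ⟩
      c ∙ c ⁻¹                ≈⟨ inverseʳ c ⟩
      ε                       ∎

  perfectCode⇒criterion : ∀ {S} → IsConnectionSet G S → PerfectCodeIn G S H → Criterion SquaresToε
  perfectCode⇒criterion S-conn code g Hgg with H? g | code g
  ... | yes Hg | _ = g ⁻¹ , ⁻¹∈ Hg , trans (∙-cong (inverseʳ g) (inverseʳ g)) (identityˡ ε)
  ... | no ¬Hg | c , (Hc , inj₁ c≈g) , _ = ⊥-elim (¬Hg (resp c≈g Hc))
  ... | no ¬Hg | c , (Hc , inj₂ adj) , unique = c ⁻¹ , ⁻¹∈ Hc ,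
    proj₁ (adjacent-codeword S-conn Hgg Hc adj (λ c′ Hc′ adj′ → unique c′ Hc′ (inj₂ adj′)))

  totalPerfectCode⇒criterion : ∀ {S} → IsConnectionSet G S → TotalPerfectCodeIn G S H →
                               Criterion IsInvolution
  totalPerfectCode⇒criterion S-conn code g Hgg =
    let c , (Hc , adj) , unique = code g in c ⁻¹ , ⁻¹∈ Hc , adjacent-codeword S-conn Hgg Hc adj unique

  involution-criterion⇒involution∈ : Criterion IsInvolution → ∃[ z ] H z × IsInvolution z
  involution-criterion⇒involution∈ criterion =
    let h , Hh , ε∙h-involution = criterion ε (resp (sym (identityˡ ε)) ε∈) in
    h , Hh , IsInvolution-resp (identityˡ h) ε∙h-involution

  record Transversal (Good : Subset G) : Set where
    field
      choose      : Carrier → Carrier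
      choose-∼    : ∀ y → choose y ∼ y
      choose-cong : ∀ {y y′} → y ∼ y′ → choose y ≈ choose y′
      choose-⁻¹   : ∀ y → choose (y ⁻¹) ≈ choose y ⁻¹
      choose-good : ∀ y → H (y ∙ y) → Good (choose y)

    module Codeword (x : Carrier) where
      s = choose (x ⁻¹)
      c = s ∙ x

      codeword∈ : H c
      codeword∈ = resp (∙-congˡ (⁻¹-involutive x)) (choose-∼ (x ⁻¹))

      c∙x⁻¹≈s : c ∙ x ⁻¹ ≈ s
      c∙x⁻¹≈s = cancelʳ (inverseʳ x) s

      s-chosen : s ≈ choose s
      s-chosen = sym (choose-cong (choose-∼ (x ⁻¹)))

      adjacent : c ∙ x ⁻¹ ≈ choose (c ∙ x ⁻¹)
      adjacent = trans c∙x⁻¹≈s (trans s-chosen (choose-cong (≈⇒∼ (sym c∙x⁻¹≈s))))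

      unique : ∀ c′ → H c′ → c′ ∙ x ⁻¹ ≈ choose (c′ ∙ x ⁻¹) → c′ ≈ c
      unique c′ Hc′ adj = begin
        c′                   ≈⟨ cancelʳ (inverseˡ x) c′ ⟨
        (c′ ∙ x ⁻¹) ∙ x      ≈⟨ ∙-congʳ (trans adj (choose-cong c′∙x⁻¹∼x⁻¹)) ⟩
        s ∙ x                ∎
        where
        c′∙x⁻¹∼x⁻¹ : c′ ∙ x ⁻¹ ∼ x ⁻¹
        c′∙x⁻¹∼x⁻¹ = ∼-trans (≈⇒∼ (comm c′ (x ⁻¹))) (∙∈-∼ Hc′)

  module _ {Good : Subset G} (T : Transversal Good) where
    open Transversal T

    transversal⇒perfectCode : IsPerfectCode G H
    transversal⇒perfectCode = S , (S-resp , (λ (¬Hε , _) → ¬Hε ε∈) , S⁻¹) , code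
      where
      S : Subset G
      S y = ¬ H y × y ≈ choose y
      S-resp : Respects G S
      S-resp y≈y′ (¬Hy , y≈) =
        (λ Hy′ → ¬Hy (resp (sym y≈y′) Hy′)) , trans (sym y≈y′) (trans y≈ (choose-cong (≈⇒∼ y≈y′)))
      S⁻¹ : ∀ {y} → S y → S (y ⁻¹)
      S⁻¹ (¬Hy , y≈) =
        (λ Hy⁻¹ → ¬Hy (resp (⁻¹-involutive _) (⁻¹∈ Hy⁻¹))) , trans (⁻¹-cong y≈) (sym (choose-⁻¹ _))
      code : PerfectCodeIn G S H
      code x with H? x
      ... | yes Hx = x , (Hx , inj₁ refl) , λ where
        c′ Hc′ (inj₁ c′≈x)      → c′≈x
        c′ Hc′ (inj₂ (¬H , _)) → ⊥-elim (¬H (∙∈ Hc′ (⁻¹∈ Hx)))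
      ... | no ¬Hx = c , (codeword∈ , inj₂ (¬Hc∙x⁻¹ , adjacent)) , unique′
        where
        open Codeword x
        ¬Hc∙x⁻¹ : ¬ H (c ∙ x ⁻¹)
        ¬Hc∙x⁻¹ Hc∙x⁻¹ = ¬Hx (∙∈-cancelʳ (resp (comm _ _) codeword∈) (resp c∙x⁻¹≈s Hc∙x⁻¹))
        unique′ : ∀ c′ → H c′ → c′ ≈ x ⊎ Adj G S x c′ → c′ ≈ c
        unique′ c′ Hc′ (inj₁ c′≈x)     = ⊥-elim (¬Hx (resp c′≈x Hc′))
        unique′ c′ Hc′ (inj₂ (_ , adj)) = unique c′ Hc′ adj

    transversal⇒totalPerfectCode : (∀ {x} → Good x → ¬ x ≈ ε) → IsTotalPerfectCode G H
    transversal⇒totalPerfectCode Good⇒≉ε = S , (S-resp , ε∉S , S⁻¹) , code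
      where
      S : Subset G
      S y = y ≈ choose y
      S-resp : Respects G S
      S-resp y≈y′ y≈ = trans (sym y≈y′) (trans y≈ (choose-cong (≈⇒∼ y≈y′)))
      ε∉S : ¬ S ε
      ε∉S ε≈ = Good⇒≉ε (choose-good ε (resp (sym (identityˡ ε)) ε∈)) (sym ε≈)
      S⁻¹ : ∀ {y} → S y → S (y ⁻¹)
      S⁻¹ y≈ = trans (⁻¹-cong y≈) (sym (choose-⁻¹ _))
      code : TotalPerfectCodeIn G S H
      code x = c , (codeword∈ , adjacent) , unique
        where open Codeword x

  module Construction (fin : IsFiniteGroup G)
                      {Good : Subset G} (Good? : ∀ x → Dec (Good x)) (Good-resp : Respects G Good)
                      (Good⇒square : ∀ {x} → Good x → x ∙ x ≈ ε) (criterion : Criterion Good) where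
    open FinCombinatorics

    N : ℕ
    N = proj₁ (proj₁ fin)

    open Listing G (proj₂ (proj₁ fin)) using (element; position; element-position)

    _∼?_ : ∀ x y → Dec (x ∼ y)
    x ∼? y = H? (x ∙ y ⁻¹)

    Pair : Carrier → Subset G
    Pair y x = x ∼ y ⊎ x ∼ y ⁻¹

    Pair-∼ : ∀ {y y′} → y ∼ y′ → Pair y ⊆ Pair y′
    Pair-∼ y∼y′ (inj₁ x∼y)   = inj₁ (∼-trans x∼y y∼y′)
    Pair-∼ y∼y′ (inj₂ x∼y⁻¹) = inj₂ (∼-trans x∼y⁻¹ (⁻¹-cong-∼ y∼y′))

    Pair-⁻¹ : ∀ {y} → Pair y ⊆ Pair (y ⁻¹)
    Pair-⁻¹ (inj₁ x∼y)   = inj₂ (∼-trans x∼y (≈⇒∼ (sym (⁻¹-involutive _))))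
    Pair-⁻¹ (inj₂ x∼y⁻¹) = inj₁ x∼y⁻¹

    Pair-⁻¹′ : ∀ {y} → Pair (y ⁻¹) ⊆ Pair y
    Pair-⁻¹′ p = Pair-∼ (≈⇒∼ (⁻¹-involutive _)) (Pair-⁻¹ p)

    HasGood : Carrier → Set
    HasGood y = ∃[ k ] Pair y (element k) × Good (element k)

    Preferred : Carrier → Fin N → Set
    Preferred y k = Pair y (element k) × (Good (element k) ⊎ ¬ HasGood y)

    Preferred-mono : ∀ {y y′} → Pair y ⊆ Pair y′ → Pair y′ ⊆ Pair y → Preferred y ⊆ Preferred y′
    Preferred-mono y⊆y′ _     (p , inj₁ good)    = y⊆y′ p , inj₁ good
    Preferred-mono y⊆y′ y′⊆y (p , inj₂ ¬good) = y⊆y′ p , inj₂ λ (k , p′ , good) → ¬good (k , y′⊆y p′ , good)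

    first-preferred : ∀ y → ∃ (Least (Preferred y))
    first-preferred y = least (λ k → Pair? (element k) ×-dec (Good? (element k) ⊎-dec ¬? HasGood?)) witness
      where
      Pair? : ∀ x → Dec (Pair y x)
      Pair? x = (x ∼? y) ⊎-dec (x ∼? (y ⁻¹))
      HasGood? : Dec (HasGood y)
      HasGood? = F.any? (λ k → Pair? (element k) ×-dec Good? (element k))
      witness : ∃ (Preferred y)
      witness with HasGood?
      ... | yes (k , p , good) = k , p , inj₁ good
      ... | no ¬good           = position y tt , inj₁ (≈⇒∼ (element-position y tt)) , inj₂ ¬good

    chosen : Carrier → Carrier
    chosen y = element (proj₁ (first-preferred y))

    chosen∈ : ∀ y → Pair y (chosen y)
    chosen∈ y = proj₁ (proj₁ (proj₂ (first-preferred y)))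

    chosen-good : ∀ {y} → HasGood y → Good (chosen y)
    chosen-good {y} hasGood with proj₂ (proj₁ (proj₂ (first-preferred y)))
    ... | inj₁ good    = good
    ... | inj₂ ¬good   = ⊥-elim (¬good hasGood)

    chosen-cong : ∀ {y y′} → Pair y ⊆ Pair y′ → Pair y′ ⊆ Pair y → chosen y ≈ chosen y′
    chosen-cong {y} {y′} y⊆y′ y′⊆y = reflexive (≡.cong element
      (Least-unique (Preferred-mono y⊆y′ y′⊆y) (Preferred-mono y′⊆y y⊆y′)
        (proj₂ (first-preferred y)) (proj₂ (first-preferred y′))))

    self-inverse-HasGood : ∀ {y} → H (y ∙ y) → HasGood y
    self-inverse-HasGood {y} Hyy = let h , Hh , good = criterion y Hyy in
      position (y ∙ h) tt ,
      inj₁ (∼-trans (≈⇒∼ (element-position _ tt)) (∙∈-∼ Hh)) ,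
      Good-resp (sym (element-position _ tt)) good

    -- chosen y depends only on the pair {H y, H y⁻¹}; orienting it into H y commutes with inversion
    -- because chosen y is Good, hence self-inverse, whenever the two cosets coincide.
    choose : Carrier → Carrier
    choose y with chosen y ∼? y
    ... | yes _ = chosen y
    ... | no _  = chosen y ⁻¹

    Pair-¬∼ : ∀ {y x} → Pair y x → ¬ x ∼ y → x ∼ y ⁻¹
    Pair-¬∼ (inj₁ x∼y)   x≁y = ⊥-elim (x≁y x∼y)
    Pair-¬∼ (inj₂ x∼y⁻¹) _   = x∼y⁻¹

    ∼⁻¹⇒square∈ : ∀ {x y} → x ∼ y → x ∼ y ⁻¹ → H (y ∙ y)
    ∼⁻¹⇒square∈ {x} {y} x∼y x∼y⁻¹ = resp (∙-congˡ (⁻¹-involutive y)) (∼-trans (∼-sym x∼y) x∼y⁻¹)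

    choose-∼ : ∀ y → choose y ∼ y
    choose-∼ y with chosen y ∼? y
    ... | yes c∼y = c∼y
    ... | no c≁y  = ∼-trans (⁻¹-cong-∼ (Pair-¬∼ (chosen∈ y) c≁y)) (≈⇒∼ (⁻¹-involutive y))

    chosen-cong-∼ : ∀ {y y′} → y ∼ y′ → chosen y ≈ chosen y′
    chosen-cong-∼ y∼y′ = chosen-cong (Pair-∼ y∼y′) (Pair-∼ (∼-sym y∼y′))

    chosen-⁻¹ : ∀ y → chosen (y ⁻¹) ≈ chosen y
    chosen-⁻¹ y = chosen-cong Pair-⁻¹′ Pair-⁻¹

    choose-cong : ∀ {y y′} → y ∼ y′ → choose y ≈ choose y′
    choose-cong {y} {y′} y∼y′ with chosen y ∼? y | chosen y′ ∼? y′
    ... | yes _   | yes _     = chosen-cong-∼ y∼y′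
    ... | yes c∼y | no c′≁y′  =
      ⊥-elim (c′≁y′ (∼-trans (≈⇒∼ (sym (chosen-cong-∼ y∼y′))) (∼-trans c∼y y∼y′)))
    ... | no c≁y  | yes c′∼y′ =
      ⊥-elim (c≁y (∼-trans (≈⇒∼ (chosen-cong-∼ y∼y′)) (∼-trans c′∼y′ (∼-sym y∼y′))))
    ... | no _    | no _      = ⁻¹-cong (chosen-cong-∼ y∼y′)

    choose-⁻¹ : ∀ y → choose (y ⁻¹) ≈ choose y ⁻¹
    choose-⁻¹ y with chosen (y ⁻¹) ∼? (y ⁻¹) | chosen y ∼? y
    ... | yes c⁻∼y⁻¹ | yes c∼y = trans (chosen-⁻¹ y) (square≈ε⇒≈⁻¹ (Good⇒square (chosen-good
      (self-inverse-HasGood (∼⁻¹⇒square∈ c∼y (∼-trans (≈⇒∼ (sym (chosen-⁻¹ y))) c⁻∼y⁻¹))))))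
    ... | yes _      | no _    = trans (chosen-⁻¹ y) (sym (⁻¹-involutive _))
    ... | no _       | yes _   = ⁻¹-cong (chosen-⁻¹ y)
    ... | no c⁻≁y⁻¹  | no c≁y  = ⊥-elim (c⁻≁y⁻¹ (∼-trans (≈⇒∼ (chosen-⁻¹ y)) (Pair-¬∼ (chosen∈ y) c≁y)))

    choose-good : ∀ y → H (y ∙ y) → Good (choose y)
    choose-good y Hyy with chosen y ∼? y | chosen-good (self-inverse-HasGood Hyy)
    ... | yes _ | good = good
    ... | no _  | good = Good-resp (square≈ε⇒≈⁻¹ (Good⇒square good)) good

    criterion⇒transversal : Transversal Good
    criterion⇒transversal = record
      { choose = choose ; choose-∼ = choose-∼ ; choose-cong = choose-cong
      ; choose-⁻¹ = choose-⁻¹ ; choose-good = choose-good }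

  module _ (fin : IsFiniteGroup G) where

    private
      _≟_ : ∀ x y → Dec (x ≈ y)
      _≟_ = proj₂ fin

    perfectCode⇔criterion : IsPerfectCode G H ⇔ Criterion SquaresToε
    perfectCode⇔criterion = mk⇔
      (λ (_ , S-conn , code) → perfectCode⇒criterion S-conn code)
      (λ criterion → transversal⇒perfectCode (Construction.criterion⇒transversal fin
        (λ x → (x ∙ x) ≟ ε) SquaresToε-resp (λ x∙x≈ε → x∙x≈ε) criterion))

    totalPerfectCode⇔criterion : IsTotalPerfectCode G H ⇔ Criterion IsInvolution
    totalPerfectCode⇔criterion = mk⇔
      (λ (_ , S-conn , code) → totalPerfectCode⇒criterion S-conn code)
      (λ criterion → transversal⇒totalPerfectCode (Construction.criterion⇒transversal fin
        (λ x → ((x ∙ x) ≟ ε) ×-dec ¬? (x ≟ ε)) IsInvolution-resp proj₁ criterion) proj₂)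

    -- A solution h with g h ≈ ε can be replaced by h z for an involution z ∈ H.
    involution∈⇒involution-criterion : ∃[ z ] H z × IsInvolution z → Criterion SquaresToε → Criterion IsInvolution
    involution∈⇒involution-criterion (z , Hz , z-involution) criterion g Hgg with criterion g Hgg
    ... | h , Hh , gh² with (g ∙ h) ≟ ε
    ...   | no gh≉ε  = h , Hh , gh² , gh≉ε
    ...   | yes gh≈ε = h ∙ z , ∙∈ Hh Hz ,
      IsInvolution-resp (sym (trans (sym (assoc g h z)) (trans (∙-congʳ gh≈ε) (identityˡ z)))) z-involution

    totalPerfectCode⇔perfectCode×involution∈ :
      IsTotalPerfectCode G H ⇔ (IsPerfectCode G H × ∃[ z ] H z × IsInvolution z)
    totalPerfectCode⇔perfectCode×involution∈ = mk⇔
      (λ total → let criterion = Equivalence.to totalPerfectCode⇔criterion total in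
        Equivalence.from perfectCode⇔criterion (λ g Hgg → let h , Hh , gh² , _ = criterion g Hgg in h , Hh , gh²)
        , involution-criterion⇒involution∈ criterion)
      (λ (perfect , involution) → Equivalence.from totalPerfectCode⇔criterion
        (involution∈⇒involution-criterion involution (Equivalence.to perfectCode⇔criterion perfect)))

module DirectDecomposition (G : AbelianGroup 0ℓ 0ℓ) (n : ℕ) (a : Fin n → AbelianGroup.Carrier G)
                           (m : Fin n → ℕ) (ord : ∀ i → HasOrder G (a i) (2 ^ m i)) where
  open AbelianGroup G
  open Powers G
  open PowersOfTwo
  open import Algebra.Properties.CommutativeMonoid.Sum +-0-commutativeMonoid using (sum; sum-remove)
  open import Relation.Binary.Reasoning.Setoid setoid

  a-order : ∀ i → pow G (a i) (2 ^ m i) ≈ ε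
  a-order i = proj₁ (proj₂ (ord i))

  a≉ε : (∀ i → 1 ≤ m i) → ∀ i → ¬ a i ≈ ε
  a≉ε m≥1 i aᵢ≈ε = proj₂ (proj₂ (ord i)) 1 (s≤s z≤n) (1<2^ (m i) (m≥1 i)) (trans (pow-1 (a i)) aᵢ≈ε)

  ≤-sum : ∀ {k} (f : Fin k → ℕ) i → f i ≤ sum f
  ≤-sum {suc k} f i = ≤-trans (m≤m+n (f i) _) (≤-reflexive (≡.sym (sum-remove {i = i} f)))

  ∑m : ℕ
  ∑m = sum m

  Gen-exponent : ∀ {x} → Gen G n a x → pow G x (2 ^ ∑m) ≈ ε
  Gen-exponent {x} (k , x≈) = begin
    pow G x E                                       ≈⟨ pow-cong E x≈ ⟩
    pow G (prodF G n (λ i → pow G (a i) (k i))) E   ≈⟨ pow-prodF n _ E ⟩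
    prodF G n (λ i → pow G (pow G (a i) (k i)) E)   ≈⟨ prodF-cong n (λ i → pow-pow-comm (a i) (k i) E) ⟩
    prodF G n (λ i → pow G (pow G (a i) E) (k i))
      ≈⟨ prodF-cong n (λ i → trans (pow-cong (k i) (aᵢᴱ≈ε i)) (pow-ε (k i))) ⟩
    prodF G n (λ _ → ε)                             ≈⟨ prodF-ε n ⟩
    ε                                               ∎
    where
    E = 2 ^ ∑m
    aᵢᴱ≈ε : ∀ i → pow G (a i) E ≈ ε
    aᵢᴱ≈ε i = trans (reflexive (≡.cong (pow G (a i)) (2^-split (≤-sum m i))))
                    (pow-*-≈ε (a i) (2 ^ m i) (2 ^ (∑m ∸ m i)) (a-order i))

  instance
    2^m≢0 : ∀ {i} → NonZero (2 ^ m i)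
    2^m≢0 {i} = m^n≢0 2 (m i)

  pow-a-mod : ∀ i t → pow G (a i) t ≈ pow G (a i) (t % 2 ^ m i)
  pow-a-mod i t = begin
    pow G (a i) t                                    ≡⟨ ≡.cong (pow G (a i)) (m≡m%n+[m/n]*n t (2 ^ m i)) ⟩
    pow G (a i) (t % 2 ^ m i + t / 2 ^ m i * 2 ^ m i) ≈⟨ pow-+ (a i) (t % 2 ^ m i) (t / 2 ^ m i * 2 ^ m i) ⟩
    pow G (a i) (t % 2 ^ m i) ∙ pow G (a i) (t / 2 ^ m i * 2 ^ m i)
      ≈⟨ ∙-congˡ (pow-*-≈ε (a i) (2 ^ m i) (t / 2 ^ m i) (a-order i)) ⟩
    pow G (a i) (t % 2 ^ m i) ∙ ε                    ≈⟨ identityʳ _ ⟩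
    pow G (a i) (t % 2 ^ m i)                        ∎

  exponents-parity : (∀ i → 1 ≤ m i) → IsDirect G n a (λ i → 2 ^ m i) →
    ∀ (u v : Fin n → ℕ) → prodF G n (λ i → pow G (a i) (u i)) ≈ prodF G n (λ i → pow G (a i) (v i)) →
    ∀ i → u i % 2 ≡ v i % 2
  exponents-parity m≥1 dir u v eq i =
    ≡.trans (≡.sym (%2^-%2 (u i) (m i) (m≥1 i)))
            (≡.trans (≡.cong (_% 2) residues-equal) (%2^-%2 (v i) (m i) (m≥1 i)))
    where
    residues-equal : u i % 2 ^ m i ≡ v i % 2 ^ m i
    residues-equal = dir (λ j → u j % 2 ^ m j) (λ j → v j % 2 ^ m j)
      (λ j → m%n<n (u j) (2 ^ m j)) (λ j → m%n<n (v j) (2 ^ m j))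
      (trans (sym (prodF-cong n (λ j → pow-a-mod j (u j))))
        (trans eq (prodF-cong n (λ j → pow-a-mod j (v j))))) i

module SylowTwo (G : AbelianGroup 0ℓ 0ℓ) (_≟_ : ∀ x y → Dec (AbelianGroup._≈_ G x y))
                {P : Subset G} (syl : IsSylow G 2 P) where
  open AbelianGroup G

  sgP : IsSubgroup G P
  sgP = proj₁ syl

  private
    K r : ℕ
    K = proj₁ (proj₂ syl)
    r = proj₁ (proj₂ (proj₂ syl))
    r-odd : ¬ 2 ∣ r
    r-odd = proj₂ (proj₂ (proj₂ (proj₂ (proj₂ syl))))

  open Subgroup G sgP
  open TwoPowerElements G using (pow-odd)
  open PowersOfTwo
  open Lagrange G _≟_ sgP (proj₁ (proj₂ (proj₂ (proj₂ syl)))) (proj₁ (proj₂ (proj₂ (proj₂ (proj₂ syl)))))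
    using (index; index*size≡size; pow-index∈)

  index≡r : index ≡ r
  index≡r = *-cancelʳ-≡ index r (2 ^ K) {{m^n≢0 2 K}} (≡.trans index*size≡size (*-comm (2 ^ K) r))

  r-form : r ≡ 1 + r / 2 * 2
  r-form with parity r
  ... | inj₂ r%2≡1 = odd-form r r%2≡1
  ... | inj₁ r%2≡0 = ⊥-elim (r-odd (m%n≡0⇒n∣m r 2 r%2≡0))

  ∙square-pow∈ : ∀ g → P (g ∙ pow G (g ∙ g) (r / 2))
  ∙square-pow∈ g = resp (trans (reflexive (≡.cong (pow G g) (≡.trans index≡r r-form))) (pow-odd g (r / 2)))
                        (pow-index∈ g)

  square-power-∙∈ : ∀ g → ∃[ h ] ⟨_⟩ G (g ∙ g) h × P (g ∙ h)
  square-power-∙∈ g = pow G (g ∙ g) (r / 2) , (r / 2 , refl) , ∙square-pow∈ g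

  square∈⇒∈ : ∀ {h} → P (h ∙ h) → P h
  square∈⇒∈ {h} Phh = ∙∈-cancelʳ (∙square-pow∈ h) (pow∈ (r / 2) Phh)

module SylowCyclicIntersection
    (G : AbelianGroup 0ℓ 0ℓ) (fin : IsFiniteGroup G)
    (n : ℕ) (a : Fin n → AbelianGroup.Carrier G) (m : Fin n → ℕ)
    (m≥1 : ∀ i → 1 ≤ m i) (ord : ∀ i → HasOrder G (a i) (2 ^ m i))
    (dir : IsDirect G n a (λ i → 2 ^ m i)) (syl : IsSylow G 2 (Gen G n a))
    {H : Subset G} (sgH : IsSubgroup G H) (H? : ∀ x → Dec (H x))
    (cyc : IsCyclic G (_∩_ G H (Gen G n a))) where
  open AbelianGroup G
  open Powers G
  open PowersOfTwo
  open CyclicSubgroup G using (∈⟨⟩)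
  open TwoPowerElements G
  open DirectDecomposition G n a m ord
  open PerfectCodes G sgH H?
  open import Algebra.Properties.Group group using (inverseʳ-unique)
  open import Algebra.Properties.AbelianGroup G using (⁻¹-∙-comm)
  open import Algebra.Properties.CommutativeSemigroup commutativeSemigroup using (interchange)
  open import Relation.Binary.Reasoning.Setoid setoid

  P : Subset G
  P = Gen G n a

  Q : Subset G
  Q = _∩_ G H P

  _≟_ : ∀ x y → Dec (x ≈ y)
  _≟_ = proj₂ fin

  open SylowTwo G _≟_ syl using (sgP; square-power-∙∈; square∈⇒∈)

  module InH = Subgroup G sgH
  module InP = Subgroup G sgP

  q : Carrier
  q = proj₁ cyc

  Q⇒⟨q⟩ : ∀ {x} → Q x → ⟨_⟩ G q x
  Q⇒⟨q⟩ {x} = Equivalence.to (proj₂ cyc x)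

  ⟨q⟩⇒Q : ∀ {x} → ⟨_⟩ G q x → Q x
  ⟨q⟩⇒Q {x} = Equivalence.from (proj₂ cyc x)

  q∈Q : Q q
  q∈Q = ⟨q⟩⇒Q (∈⟨⟩ q)

  pow-q∈Q : ∀ t → Q (pow G q t)
  pow-q∈Q t = ⟨q⟩⇒Q (t , refl)

  k : Fin n → ℕ
  k = proj₁ (proj₂ q∈Q)

  pow-q : ∀ t → pow G q t ≈ prodF G n (λ l → pow G (a l) (t * k l))
  pow-q t = begin
    pow G q t                                          ≈⟨ pow-cong t (proj₂ (proj₂ q∈Q)) ⟩
    pow G (prodF G n (λ l → pow G (a l) (k l))) t      ≈⟨ pow-prodF n _ t ⟩
    prodF G n (λ l → pow G (pow G (a l) (k l)) t)      ≈⟨ prodF-cong n (λ l → pow-* (a l) t (k l)) ⟨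
    prodF G n (λ l → pow G (a l) (t * k l))            ∎

  q-exponent : pow G q (2 ^ ∑m) ≈ ε
  q-exponent = Gen-exponent (proj₂ q∈Q)

  ProjectionFull : Fin n → Set
  ProjectionFull = ProjEqualsFactor G n a Q

  exponents-parity-q : ∀ {x} (c : Fin n → ℕ) (t : ℕ) → x ≈ prodF G n (λ l → pow G (a l) (c l)) →
                       x ≈ pow G q t → ∀ i → c i % 2 ≡ (t * k i) % 2
  exponents-parity-q c t x≈ x≈qᵗ =
    exponents-parity m≥1 dir c (λ l → t * k l) (trans (sym x≈) (trans x≈qᵗ (pow-q t)))

  odd⇒projection-full : ∀ i → k i % 2 ≡ 1 → ProjectionFull i
  odd⇒projection-full i kᵢ-odd y = mk⇔ (λ (_ , _ , c , _ , y≈) → c i , y≈) from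
    where
    t = proj₁ (∈⟨odd-pow⟩ (m i) (a i) (k i) (a-order i) kᵢ-odd)
    aᵢ≈ : a i ≈ pow G (pow G (a i) (k i)) t
    aᵢ≈ = proj₂ (∈⟨odd-pow⟩ (m i) (a i) (k i) (a-order i) kᵢ-odd)
    from : ⟨_⟩ G (a i) y → ∃[ x ] Q x × ProjIs G n a i x y
    from (j , y≈) = pow G q (j * t) , pow-q∈Q (j * t) , (λ l → j * t * k l) , pow-q (j * t) , (begin
      y                                  ≈⟨ y≈ ⟩
      pow G (a i) j                      ≈⟨ pow-cong j aᵢ≈ ⟩
      pow G (pow G (pow G (a i) (k i)) t) j ≈⟨ pow-* _ j t ⟨
      pow G (pow G (a i) (k i)) (j * t)  ≈⟨ pow-* (a i) (j * t) (k i) ⟨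
      pow G (a i) (j * t * k i)          ∎)

  projection-full⇒odd : ∀ i → ProjectionFull i → k i % 2 ≡ 1
  projection-full⇒odd i full =
    let x , Qx , c , x≈ , aᵢ≈ = Equivalence.from (full (a i)) (∈⟨⟩ (a i))
        s , x≈qˢ = Q⇒⟨q⟩ Qx
    in *-odd⇒odd s (k i) (≡.trans (≡.sym (exponents-parity-q c s x≈ x≈qˢ i))
                                   (self-pow⇒odd (m i) (a i) (c i) (a-order i) (a≉ε m≥1 i) aᵢ≈))

  projection-full⇒q≉ε : ∀ i → ProjectionFull i → ¬ q ≈ ε
  projection-full⇒q≉ε i full q≈ε with ≡.trans (≡.sym (projection-full⇒odd i full))
    (exponents-parity-q k 0 (proj₂ (proj₂ q∈Q)) q≈ε i)
  ... | ()

  SquareRootsInQ : Set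
  SquareRootsInQ = ∀ {g} → P g → H (g ∙ g) → ∃[ v ] Q v × g ∙ g ≈ v ∙ v

  -- The exponent t of g² = q^t is even because the i-th exponent of g² is, while k i is odd.
  trivial⊎projection-full⇒square-roots : IsTrivial G Q ⊎ ∃[ i ] ProjectionFull i → SquareRootsInQ
  trivial⊎projection-full⇒square-roots (inj₁ trivial) Pg Hgg =
    ε , (InH.ε∈ , InP.ε∈) , trans (trivial _ (Hgg , InP.∙∈ Pg Pg)) (sym (identityˡ ε))
  trivial⊎projection-full⇒square-roots (inj₂ (i , full)) {g} Pg@(l , g≈) Hgg =
    pow G q (t / 2) , pow-q∈Q (t / 2) , trans g∙g≈qᵗ (pow-even q t t-even)
    where
    t : ℕ
    t = proj₁ (Q⇒⟨q⟩ (Hgg , InP.∙∈ Pg Pg))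
    g∙g≈qᵗ : g ∙ g ≈ pow G q t
    g∙g≈qᵗ = proj₂ (Q⇒⟨q⟩ (Hgg , InP.∙∈ Pg Pg))
    g∙g≈ : g ∙ g ≈ prodF G n (λ j → pow G (a j) (l j + l j))
    g∙g≈ = trans (∙-cong g≈ g≈)
      (trans (sym (prodF-∙ n _ _)) (prodF-cong n (λ j → sym (pow-+ (a j) (l j) (l j)))))
    t-even : t % 2 ≡ 0
    t-even = *-even⇒even t (k i)
      (≡.trans (≡.sym (exponents-parity-q (λ j → l j + l j) t g∙g≈ g∙g≈qᵗ i)) (double-even (l i)))
      (projection-full⇒odd i full)

  -- Multiplying g by a power of g² moves it into P, so square roots for elements of P suffice.
  square-roots⇒criterion : SquareRootsInQ → Criterion SquaresToε
  square-roots⇒criterion roots g Hgg = g₀ ∙ v ⁻¹ , InH.∙∈ Hg₀ (InH.⁻¹∈ (proj₁ Qv)) , (begin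
    (g ∙ (g₀ ∙ v ⁻¹)) ∙ (g ∙ (g₀ ∙ v ⁻¹)) ≈⟨ ∙-cong (assoc g g₀ (v ⁻¹)) (assoc g g₀ (v ⁻¹)) ⟨
    (g′ ∙ v ⁻¹) ∙ (g′ ∙ v ⁻¹)             ≈⟨ interchange g′ (v ⁻¹) g′ (v ⁻¹) ⟩
    (g′ ∙ g′) ∙ (v ⁻¹ ∙ v ⁻¹)             ≈⟨ ∙-congˡ (⁻¹-∙-comm v v) ⟩
    (g′ ∙ g′) ∙ (v ∙ v) ⁻¹                ≈⟨ ∙-congʳ g′∙g′≈v∙v ⟩
    (v ∙ v) ∙ (v ∙ v) ⁻¹                  ≈⟨ inverseʳ (v ∙ v) ⟩
    ε                                     ∎)
    where
    g₀ = proj₁ (square-power-∙∈ g)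
    g′ = g ∙ g₀
    Hg₀ : H g₀
    Hg₀ = let e , g₀≈ = proj₁ (proj₂ (square-power-∙∈ g)) in InH.resp (sym g₀≈) (InH.pow∈ e Hgg)
    root = roots (proj₂ (proj₂ (square-power-∙∈ g)))
                 (InH.resp (sym (interchange g g₀ g g₀)) (InH.∙∈ Hgg (InH.∙∈ Hg₀ Hg₀)))
    v = proj₁ root
    Qv = proj₁ (proj₂ root)
    g′∙g′≈v∙v = proj₂ (proj₂ root)

  -- If all k i are even then q = p² with p ∈ P; a solution h for p satisfies h² = q⁻¹, so h ∈ Q,
  -- h = q^u and q^(1+2u) = ε, which forces q = ε as q has 2-power order.
  even-exponents⇒q≈ε : Criterion SquaresToε → (∀ i → k i % 2 ≡ 0) → q ≈ ε
  even-exponents⇒q≈ε criterion k-even = pow-2^-odd⇒≈ε ∑m q u q-exponent (begin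
    pow G q (1 + u * 2)          ≈⟨ pow-odd q u ⟩
    q ∙ pow G (q ∙ q) u          ≈⟨ ∙-congˡ (pow-∙ q q u) ⟩
    q ∙ (pow G q u ∙ pow G q u)  ≈⟨ ∙-congˡ (∙-cong h≈qᵘ h≈qᵘ) ⟨
    q ∙ (h ∙ h)                  ≈⟨ q∙h∙h≈ε ⟩
    ε                            ∎)
    where
    p = prodF G n (λ i → pow G (a i) (k i / 2))
    p∙p≈q : p ∙ p ≈ q
    p∙p≈q = trans (sym (prodF-∙ n _ _))
      (trans (prodF-cong n (λ i → sym (pow-even (a i) (k i) (k-even i)))) (sym (proj₂ (proj₂ q∈Q))))
    solution = criterion p (InH.resp (sym p∙p≈q) (proj₁ q∈Q))
    h = proj₁ solution
    q∙h∙h≈ε : q ∙ (h ∙ h) ≈ ε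
    q∙h∙h≈ε = trans (∙-congʳ (sym p∙p≈q)) (trans (sym (interchange p h p h)) (proj₂ (proj₂ solution)))
    Ph : P h
    Ph = square∈⇒∈ (InP.resp (sym (inverseʳ-unique q (h ∙ h) q∙h∙h≈ε)) (InP.⁻¹∈ (proj₂ q∈Q)))
    u = proj₁ (Q⇒⟨q⟩ (proj₁ (proj₂ solution) , Ph))
    h≈qᵘ : h ≈ pow G q u
    h≈qᵘ = proj₂ (Q⇒⟨q⟩ (proj₁ (proj₂ solution) , Ph))

  criterion⇒trivial⊎projection-full : Criterion SquaresToε → IsTrivial G Q ⊎ ∃[ i ] ProjectionFull i
  criterion⇒trivial⊎projection-full criterion with q ≟ ε
  ... | yes q≈ε = inj₁ λ x Qx → let t , x≈qᵗ = Q⇒⟨q⟩ Qx in trans x≈qᵗ (trans (pow-cong t q≈ε) (pow-ε t))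
  ... | no q≉ε with F.any? (λ i → k i % 2 ℕ.≟ 1)
  ...   | yes (i , kᵢ-odd) = inj₂ (i , odd⇒projection-full i kᵢ-odd)
  ...   | no no-odd        = ⊥-elim (q≉ε (even-exponents⇒q≈ε criterion k-even))
    where
    k-even : ∀ i → k i % 2 ≡ 0
    k-even i with parity (k i)
    ... | inj₁ kᵢ-even = kᵢ-even
    ... | inj₂ kᵢ-odd  = ⊥-elim (no-odd (i , kᵢ-odd))

  criterion⇔trivial⊎projection-full : Criterion SquaresToε ⇔ (IsTrivial G Q ⊎ ∃[ i ] ProjectionFull i)
  criterion⇔trivial⊎projection-full = mk⇔ criterion⇒trivial⊎projection-full
    (λ rhs → square-roots⇒criterion (trivial⊎projection-full⇒square-roots rhs))

  involution∈⇒nontrivial : ∃[ z ] H z × IsInvolution z → ¬ IsTrivial G Q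
  involution∈⇒nontrivial (z , Hz , z∙z≈ε , z≉ε) trivial =
    z≉ε (trivial z (Hz , square∈⇒∈ (InP.resp (sym z∙z≈ε) InP.ε∈)))

  projection-full⇒involution∈ : ∀ i → ProjectionFull i → ∃[ z ] H z × IsInvolution z
  projection-full⇒involution∈ i full =
    let z , z∈⟨q⟩ , z-involution = involution∈⟨⟩ _≟_ ∑m q q-exponent (projection-full⇒q≉ε i full)
    in z , proj₁ (⟨q⟩⇒Q z∈⟨q⟩) , z-involution

  perfectCode×involution∈⇔projection-full :
    (IsPerfectCode G H × ∃[ z ] H z × IsInvolution z) ⇔ (∃[ i ] ProjectionFull i)
  perfectCode×involution∈⇔projection-full = mk⇔
    (λ (perfect , involution) → [ ⊥-elim ∘ involution∈⇒nontrivial involution , id ]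
      (Equivalence.to criterion⇔trivial⊎projection-full (Equivalence.to (perfectCode⇔criterion fin) perfect)))
    (λ (i , full) → Equivalence.from (perfectCode⇔criterion fin)
        (Equivalence.from criterion⇔trivial⊎projection-full (inj₂ (i , full)))
      , projection-full⇒involution∈ i full)

theorem2p7 : (G : AbelianGroup 0ℓ 0ℓ) → IsFiniteGroup G
  → (n : ℕ) (a : Fin n → AbelianGroup.Carrier G) (m : Fin n → ℕ)
  → (∀ i → 1 ≤ m i)
  → (∀ i → HasOrder G (a i) (2 ^ m i))
  → IsDirect G n a (λ i → 2 ^ m i)
  → IsSylow G 2 (Gen G n a)
  → (H : AbelianGroup.Carrier G → Set) → IsSubgroup G H → (∀ x → Dec (H x))
  → IsCyclic G (_∩_ G H (Gen G n a))
  → (IsPerfectCode G H ⇔ (IsTrivial G (_∩_ G H (Gen G n a))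
        ⊎ ∃[ i ] ProjEqualsFactor G n a (_∩_ G H (Gen G n a)) i))
  × (IsTotalPerfectCode G H ⇔ (∃[ i ] ProjEqualsFactor G n a (_∩_ G H (Gen G n a)) i))
theorem2p7 G fin n a m m≥1 ord dir syl H sgH H? cyc =
    ⇔-trans (perfectCode⇔criterion fin) criterion⇔trivial⊎projection-full
  , ⇔-trans (totalPerfectCode⇔perfectCode×involution∈ fin) perfectCode×involution∈⇔projection-full
  where
  open PerfectCodes G sgH H?
  open SylowCyclicIntersection G fin n a m m≥1 ord dir syl sgH H? cyc
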